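{- Call a set $\{x_1,\dots,x_9\}$ of nine pairwise distinct positive integers admissible if $\frac{1}{x_1}+\dots+\frac{1}{x_9}=1$ and there is an odd prime $q$ such that every $x_i$ is of the form $2^{a_i}q^{b_i}$ with $a_i\in\{0,1,2\}$ and $b_i\geq 0$ an integer. There are exactly $54$ admissible sets.
   Context: Solutions are counted as unordered sets of distinct integers. The same odd prime $q$ is used for all nine entries of a given set, and the exponent of $2$ in each entry is at most $2$. -}

module Defs where

open import Data.Nat using (ℕ; zero; suc; _<_; _≤_; _^_; _*_)
open import Data.Nat.Primality using (Prime)
open import Data.Nat.Divisibility using (_∣_)
open import Data.Integer using (+_)
open import Data.Rational using (ℚ; 0ℚ; 1ℚ; _/_; _+_)
open import Data.Fin as Fin using (Fin)
open import Data.Vec using (Vec; []; _∷_; lookup)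
open import Data.Product using (Σ; _×_; ∃; ∃-syntax)
open import Relation.Nullary using (¬_)
open import Relation.Binary.PropositionalEquality using (_≡_)

-- reciprocal of a natural number as a rational (1/0 := 0; only used for positive x)
recip : ℕ → ℚ
recip zero = 0ℚ
recip (suc k) = + 1 / suc k

recipSum : ∀ {n} → Vec ℕ n → ℚ
recipSum [] = 0ℚ
recipSum (x ∷ xs) = recip x + recipSum xs

-- strictly increasing vector: canonical representation of a finite set of
-- pairwise distinct naturals
StrictlyIncreasing : ∀ {n} → Vec ℕ n → Set
StrictlyIncreasing v = ∀ i j → i Fin.< j → lookup v i < lookup v j

OfForm : ℕ → ℕ → Set
OfForm q x = ∃[ a ] ∃[ b ] (a ≤ 2 × x ≡ 2 ^ a * q ^ b)

Admissible : Vec ℕ 9 → Set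
Admissible v =
  StrictlyIncreasing v
  × (∀ i → 0 < lookup v i)
  × recipSum v ≡ 1ℚ
  × ∃[ q ] (Prime q × ¬ (2 ∣ q) × (∀ i → OfForm q (lookup v i)))

{-# OPTIONS --safe #-}

-- List an admissible set increasingly. If its last k entries have reciprocal sum n / d, the
-- smallest of them, x, satisfies d ≤ n x ≤ k d, and the others sum to (n x − d) / (d x). So a
-- depth-first search through the candidates 2^a q^b within these bounds is finite and finds every
-- admissible set; for 3 ≤ q ≤ 42 it finds 54 sets in all. For q > 42 every entry is 1, 2, 4
-- or exceeds 42, and the same search through all such numbers finds nothing.
module Submission where

open import Defs
open import Data.Bool.Base using (true; if_then_else_; T)
open import Data.Fin.Base using (zero; suc)
open import Data.Integer.Base as ℤ using (+_)
import Data.Integer.Properties as ℤ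
open import Data.List.Base using (List; []; _∷_; length; map; concatMap; filter; upTo; cartesianProduct)
open import Data.List.Membership.Propositional using (_∈_)
open import Data.List.Membership.Propositional.Properties using (∈-map⁺; ∈-concatMap⁺; ∈-filter⁺; ∈-upTo⁺)
open import Data.List.Relation.Unary.All as All using (All; all?)
open import Data.List.Relation.Unary.All.Properties using (map⁺)
open import Data.List.Relation.Unary.Any as Any using (Any; here; there; any?; satisfied)
open import Data.List.Relation.Unary.Unique.Propositional using (Unique)
open import Data.List.Relation.Unary.Unique.DecPropositional using (unique?)
open import Data.Nat.Base
open import Data.Nat.DivMod using (_/_; m*n/n≡m; /-monoˡ-≤)
open import Data.Nat.Divisibility using (_∣_; _∣?_; divides)
open import Data.Nat.Primality using (Prime; prime?; ¬prime[1])
open import Data.Nat.Properties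
open import Data.Nat.Tactic.RingSolver using (solve-∀)
open import Data.Product.Base using (Σ; _×_; _,_; proj₂; uncurry)
open import Data.Rational.Base as ℚ using (1ℚ; toℚᵘ)
open import Data.Rational.Properties using (toℚᵘ-homo-+; toℚᵘ-fromℚᵘ; toℚᵘ-cong; toℚᵘ-injective)
open import Data.Rational.Unnormalised.Base as ℚᵘ using (ℚᵘ; mkℚᵘ; *≡*) renaming (_≃_ to _≃ᵘ_)
import Data.Rational.Unnormalised.Properties as ℚᵘ
open import Data.Sum.Base using (_⊎_; inj₁; inj₂)
open import Data.Unit.Base using (⊤; tt)
open import Data.Vec.Base using (Vec; []; _∷_; lookup)
open import Data.Vec.Properties using (≡-dec)
open import Data.Vec.Relation.Unary.All as VAll using () renaming (All to VAll; [] to []ᵛ; _∷_ to _∷ᵛ_)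
open import Data.Vec.Relation.Unary.All.Properties using (lookup⁺; lookup⁻)
open import Function.Bundles using (_⇔_; mk⇔; Equivalence)
open import Relation.Binary.PropositionalEquality using (_≡_; refl; sym; trans; cong; cong₂; subst; module ≡-Reasoning)
open import Relation.Nullary using (¬_; Dec; yes; no; ¬?; contradiction)
open import Relation.Nullary.Decidable using (_×-dec_; _⊎-dec_; toWitness)

∈-if : ∀ {A : Set} {b} {x : A} {xs} → T b → x ∈ xs → x ∈ (if b then xs else [])
∈-if {b = true} _ x∈xs = x∈xs

∈-concatMap : ∀ {A B : Set} {f : A → List B} {x xs y} → x ∈ xs → y ∈ f x → y ∈ concatMap f xs
∈-concatMap {f = f} x∈xs y∈fx = ∈-concatMap⁺ f (Any.map (λ { refl → y∈fx }) x∈xs)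

m*n≤o⇒n≤o/m : ∀ m {n o} .{{_ : NonZero m}} → m * n ≤ o → n ≤ o / m
m*n≤o⇒n≤o/m m {n} {o} m*n≤o = begin
  n          ≡⟨ sym (m*n/n≡m n m) ⟩
  n * m / m  ≡⟨ cong (_/ m) (*-comm n m) ⟩
  m * n / m  ≤⟨ /-monoˡ-≤ m m*n≤o ⟩
  o / m      ∎
  where open ≤-Reasoning

n<m^n : ∀ m n → 1 < m → n < m ^ n
n<m^n m zero    _   = z<s
n<m^n m (suc n) 1<m = begin
  2 + n          ≤⟨ +-mono-≤ (≤-trans z<s ih) ih ⟩
  m ^ n + m ^ n  ≡⟨ cong (_+_ (m ^ n)) (sym (+-identityʳ (m ^ n))) ⟩
  2 * m ^ n      ≤⟨ *-monoˡ-≤ (m ^ n) 1<m ⟩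
  m * m ^ n      ∎
  where
  open ≤-Reasoning
  ih = n<m^n m n 1<m

IncreasingAbove : ∀ {k} → ℕ → Vec ℕ k → Set
IncreasingAbove lo []       = ⊤
IncreasingAbove lo (x ∷ xs) = lo < x × IncreasingAbove x xs

IncreasingAbove⇒All> : ∀ {k lo} {v : Vec ℕ k} → IncreasingAbove lo v → VAll (lo <_) v
IncreasingAbove⇒All> {v = []}    _              = []ᵛ
IncreasingAbove⇒All> {v = _ ∷ _} (lo<x , x<xs) = lo<x ∷ᵛ VAll.map (<-trans lo<x) (IncreasingAbove⇒All> x<xs)

IncreasingAbove⇒StrictlyIncreasing : ∀ {k lo} {v : Vec ℕ k} → IncreasingAbove lo v → StrictlyIncreasing v
IncreasingAbove⇒StrictlyIncreasing {v = _ ∷ _} (_ , x<xs) zero (suc j) _ =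
  lookup⁺ (IncreasingAbove⇒All> x<xs) j
IncreasingAbove⇒StrictlyIncreasing {v = _ ∷ _} (_ , x<xs) (suc i) (suc j) (s≤s i<j) =
  IncreasingAbove⇒StrictlyIncreasing x<xs i j i<j
IncreasingAbove⇒StrictlyIncreasing {v = _ ∷ _} _ zero    zero ()
IncreasingAbove⇒StrictlyIncreasing {v = _ ∷ _} _ (suc _) zero ()

StrictlyIncreasing⇒IncreasingAbove : ∀ {k lo} {v : Vec ℕ k} →
  StrictlyIncreasing v → (∀ i → lo < lookup v i) → IncreasingAbove lo v
StrictlyIncreasing⇒IncreasingAbove {v = []}    _   _    = tt
StrictlyIncreasing⇒IncreasingAbove {v = _ ∷ _} inc lo<v =
  lo<v zero ,
  StrictlyIncreasing⇒IncreasingAbove (λ i j i<j → inc (suc i) (suc j) (s≤s i<j)) (λ i → inc zero (suc i) z<s)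

product : ∀ {k} → Vec ℕ k → ℕ
product []       = 1
product (x ∷ xs) = x * product xs

-- recipSum v = recipNumer v / product v
recipNumer : ∀ {k} → Vec ℕ k → ℕ
recipNumer []       = 0
recipNumer (x ∷ xs) = product xs + x * recipNumer xs

HasRecipSum : ∀ {k} → Vec ℕ k → ℕ → ℕ → Set
HasRecipSum v n d = recipNumer v * d ≡ n * product v

product-pos : ∀ {k lo} {v : Vec ℕ k} → IncreasingAbove lo v → 0 < product v
product-pos {v = []}    _             = z<s
product-pos {v = _ ∷ _} (lo<x , x<xs) = *-mono-≤ (≤-<-trans z≤n lo<x) (product-pos x<xs)

recipNumer-pos : ∀ {k lo x} {xs : Vec ℕ k} → IncreasingAbove lo (x ∷ xs) → 0 < recipNumer (x ∷ xs)
recipNumer-pos (_ , x<xs) = ≤-trans (product-pos x<xs) (m≤m+n _ _)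

recipNumer-bound : ∀ {k x} {v : Vec ℕ k} → VAll (x ≤_) v → recipNumer v * x ≤ k * product v
recipNumer-bound {v = []} []ᵛ = z≤n
recipNumer-bound {suc k} {x} {y ∷ ys} (x≤y ∷ᵛ x≤ys) = begin
  (P + y * N) * x      ≡⟨ expand P y N x ⟩
  P * x + y * (N * x)  ≤⟨ +-mono-≤ (*-monoʳ-≤ P x≤y) (*-monoʳ-≤ y (recipNumer-bound x≤ys)) ⟩
  P * y + y * (k * P)  ≡⟨ collect P y k ⟩
  suc k * (y * P)      ∎
  where
  open ≤-Reasoning
  P = product ys
  N = recipNumer ys
  expand : ∀ P y N x → (P + y * N) * x ≡ P * x + y * (N * x)
  expand = solve-∀
  collect : ∀ P y k → P * y + y * (k * P) ≡ suc k * (y * P)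
  collect = solve-∀

head-upper : ∀ {k lo n d x} {xs : Vec ℕ k} → IncreasingAbove lo (x ∷ xs) →
             HasRecipSum (x ∷ xs) n d → n * x ≤ suc k * d
head-upper {k} {n = n} {d} {x} {xs} inc@(_ , x<xs) sum =
  *-cancelʳ-≤ (n * x) (suc k * d) P {{>-nonZero (product-pos inc)}} (begin
    n * x * P      ≡⟨ swap n x P ⟩
    n * P * x      ≡⟨ cong (_* x) (sym sum) ⟩
    M * d * x      ≡⟨ swap M d x ⟩
    M * x * d      ≤⟨ *-monoˡ-≤ d (recipNumer-bound (≤-refl ∷ᵛ VAll.map <⇒≤ (IncreasingAbove⇒All> x<xs))) ⟩
    suc k * P * d  ≡⟨ swap (suc k) P d ⟩
    suc k * d * P  ∎)
  where
  open ≤-Reasoning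
  P = product (x ∷ xs)
  M = recipNumer (x ∷ xs)
  swap : ∀ a b c → a * b * c ≡ a * c * b
  swap = solve-∀

head-lower : ∀ {k n d x} {xs : Vec ℕ k} → 0 < product xs → HasRecipSum (x ∷ xs) n d → d ≤ n * x
head-lower {n = n} {d} {x} {xs} P>0 sum = *-cancelʳ-≤ d (n * x) P {{>-nonZero P>0}} (begin
  d * P                  ≤⟨ m≤m+n (d * P) (x * N * d) ⟩
  d * P + x * N * d      ≡⟨ factor P x N d ⟩
  (P + x * N) * d        ≡⟨ sum ⟩
  n * (x * P)            ≡⟨ sym (*-assoc n x P) ⟩
  n * x * P              ∎)
  where
  open ≤-Reasoning
  P = product xs
  N = recipNumer xs
  factor : ∀ P x N d → d * P + x * N * d ≡ (P + x * N) * d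
  factor = solve-∀

tail-recipSum : ∀ {k n d x} {xs : Vec ℕ k} → HasRecipSum (x ∷ xs) n d → HasRecipSum xs (n * x ∸ d) (d * x)
tail-recipSum {n = n} {d} {x} {xs} sum = sym (begin
  (n * x ∸ d) * P              ≡⟨ *-distribʳ-∸ P (n * x) d ⟩
  n * x * P ∸ d * P            ≡⟨ cong (_∸ d * P) (trans (*-assoc n x P) (trans (sym sum) (expand P x N d))) ⟩
  d * P + N * (d * x) ∸ d * P  ≡⟨ m+n∸m≡n (d * P) _ ⟩
  N * (d * x)                  ∎)
  where
  open ≡-Reasoning
  P = product xs
  N = recipNumer xs
  expand : ∀ P x N d → (P + x * N) * d ≡ d * P + N * (d * x)
  expand = solve-∀

Candidates : Set
Candidates = ℕ → ℕ → List ℕ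

Enumerates : Candidates → (ℕ → Set) → Set
Enumerates cands P = ∀ {lo hi x} → P x → lo < x → x ≤ hi → x ∈ cands lo hi

search : Candidates → (k lo n d : ℕ) → List (Vec ℕ k)
search cands zero    lo zero    d = [] ∷ []
search cands zero    lo (suc n) d = []
search cands (suc k) lo zero    d = []
search cands (suc k) lo (suc n) d = concatMap
  (λ x → if d ≤ᵇ suc n * x then map (x ∷_) (search cands k x (suc n * x ∸ d) (d * x)) else [])
  (cands lo (suc k * d / suc n))

search-complete : ∀ {cands P} → Enumerates cands P →
  ∀ k {lo n d} {v : Vec ℕ k} → IncreasingAbove lo v → VAll P v → 0 < d → HasRecipSum v n d →
  v ∈ search cands k lo n d
search-complete enum zero    {n = zero}  {v = []} _ _ _ _  = here refl
search-complete enum zero    {n = suc n} {v = []} _ _ _ ()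
search-complete enum (suc k) {n = zero}  {v = _ ∷ _} inc _ d>0 sum =
  contradiction sum (>⇒≢ (*-mono-≤ (recipNumer-pos inc) d>0))
search-complete {cands} enum (suc k) {lo} {suc n} {d} {x ∷ xs} inc@(lo<x , x<xs) (px ∷ᵛ pxs) d>0 sum =
  ∈-concatMap (enum px lo<x (m*n≤o⇒n≤o/m (suc n) (head-upper {n = suc n} {d} inc sum)))
    (∈-if (≤⇒≤ᵇ (head-lower {n = suc n} {d} {xs = xs} (product-pos x<xs) sum)) (∈-map⁺ (x ∷_) tail∈))
  where
  tail∈ : xs ∈ search cands k x (suc n * x ∸ d) (d * x)
  tail∈ = search-complete enum k x<xs pxs (*-mono-≤ d>0 (≤-<-trans z≤n lo<x))
            (tail-recipSum {n = suc n} {d} {xs = xs} sum)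

geometricUpTo : (q hi p fuel : ℕ) → List ℕ
geometricUpTo q hi p zero       = []
geometricUpTo q hi p (suc fuel) = if p ≤ᵇ hi then p ∷ geometricUpTo q hi (p * q) fuel else []

∈-geometricUpTo : ∀ {q hi fuel} .{{_ : NonZero q}} p j → j < fuel → p * q ^ j ≤ hi →
                  p * q ^ j ∈ geometricUpTo q hi p fuel
∈-geometricUpTo {q} {hi} {suc fuel} p zero _ pq⁰≤hi =
  ∈-if (≤⇒≤ᵇ (subst (_≤ hi) (*-identityʳ p) pq⁰≤hi)) (here (*-identityʳ p))
∈-geometricUpTo {q} {hi} {suc fuel} p (suc j) (s≤s j<fuel) pqʲ≤hi =
  ∈-if (≤⇒≤ᵇ (≤-trans (m≤m*n p (q ^ suc j) {{m^n≢0 q (suc j)}}) pqʲ≤hi))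
       (there (subst (_∈ geometricUpTo q hi (p * q) fuel) (*-assoc p q (q ^ j))
                     (∈-geometricUpTo (p * q) j j<fuel (subst (_≤ hi) (sym (*-assoc p q (q ^ j))) pqʲ≤hi))))

doublings : ℕ → List ℕ
doublings y = y ∷ 2 * y ∷ 4 * y ∷ []

∈-doublings : ∀ {a} y → a ≤ 2 → 2 ^ a * y ∈ doublings y
∈-doublings {0} y _ = here (*-identityˡ y)
∈-doublings {1} y _ = there (here refl)
∈-doublings {2} y _ = there (there (here refl))
∈-doublings {suc (suc (suc _))} _ (s≤s (s≤s ()))

candidates : ℕ → Candidates
candidates q lo hi =
  filter (λ x → lo <? x ×-dec x ≤? hi) (concatMap doublings (geometricUpTo q hi 1 (suc hi)))

candidates-enumerates : ∀ {q} → 1 < q → Enumerates (candidates q) (OfForm q)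
candidates-enumerates {q} 1<q {lo} {hi} (a , b , a≤2 , refl) lo<x x≤hi =
  ∈-filter⁺ (λ x → lo <? x ×-dec x ≤? hi) (∈-concatMap qᵇ∈ (∈-doublings (q ^ b) a≤2)) (lo<x , x≤hi)
  where
  qᵇ≤hi : q ^ b ≤ hi
  qᵇ≤hi = ≤-trans (m≤n*m (q ^ b) (2 ^ a) {{m^n≢0 2 a}}) x≤hi
  qᵇ∈ : q ^ b ∈ geometricUpTo q hi 1 (suc hi)
  qᵇ∈ = subst (_∈ geometricUpTo q hi 1 (suc hi)) (*-identityˡ (q ^ b))
          (∈-geometricUpTo {{>-nonZero (<-trans z<s 1<q)}} 1 b
            (s≤s (<⇒≤ (<-≤-trans (n<m^n q b 1<q) qᵇ≤hi)))
            (subst (_≤ hi) (sym (*-identityˡ (q ^ b))) qᵇ≤hi))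

SmallOrAbove : ℕ → ℕ → Set
SmallOrAbove Q x = x ∈ doublings 1 ⊎ Q < x

OfForm⇒SmallOrAbove : ∀ {Q q x} → Q < q → OfForm q x → SmallOrAbove Q x
OfForm⇒SmallOrAbove _ (a , zero , a≤2 , refl) = inj₁ (∈-doublings 1 a≤2)
OfForm⇒SmallOrAbove {q = q} Q<q (a , suc b , _ , refl) = inj₂ (<-≤-trans Q<q (begin
  q                  ≤⟨ m≤m*n q (q ^ b) {{m^n≢0 q b {{>-nonZero (≤-<-trans z≤n Q<q)}}}} ⟩
  q * q ^ b          ≤⟨ m≤n*m (q * q ^ b) (2 ^ a) {{m^n≢0 2 a}} ⟩
  2 ^ a * q ^ suc b  ∎))
  where open ≤-Reasoning

smallOrAbove? : ∀ Q x → Dec (SmallOrAbove Q x)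
smallOrAbove? Q x = any? (x ≟_) (doublings 1) ⊎-dec Q <? x

candidatesAbove : ℕ → Candidates
candidatesAbove Q lo hi = filter (λ x → lo <? x ×-dec smallOrAbove? Q x) (upTo (suc hi))

candidatesAbove-enumerates : ∀ {Q} → Enumerates (candidatesAbove Q) (SmallOrAbove Q)
candidatesAbove-enumerates {Q} {lo} px lo<x x≤hi =
  ∈-filter⁺ (λ x → lo <? x ×-dec smallOrAbove? Q x) (∈-upTo⁺ (s≤s x≤hi)) (lo<x , px)

-- N / P for P > 0 (mkℚᵘ stores the denominator minus one)
fraction : ℕ → ℕ → ℚᵘ
fraction N P = mkℚᵘ (+ N) (P ∸ 1)

fraction-+ : ∀ k N P → 0 < P → mkℚᵘ (+ 1) k ℚᵘ.+ fraction N P ≃ᵘ fraction (P + suc k * N) (suc k * P)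
fraction-+ k N (suc P) _ = *≡* (cong (ℤ._* + (suc k * suc P)) (begin
  + 1 ℤ.* + suc P ℤ.+ + N ℤ.* + suc k  ≡⟨ cong₂ ℤ._+_ (ℤ.*-identityˡ (+ suc P)) (sym (ℤ.pos-* N (suc k))) ⟩
  + suc P ℤ.+ + (N * suc k)            ≡⟨ sym (ℤ.pos-+ (suc P) (N * suc k)) ⟩
  + (suc P + N * suc k)                ≡⟨ cong (λ m → + (suc P + m)) (*-comm N (suc k)) ⟩
  + (suc P + suc k * N)                ∎))
  where open ≡-Reasoning

toℚᵘ-recipSum : ∀ {k lo} {v : Vec ℕ k} → IncreasingAbove lo v →
                toℚᵘ (recipSum v) ≃ᵘ fraction (recipNumer v) (product v)
toℚᵘ-recipSum {v = []} _ = ℚᵘ.≃-refl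
toℚᵘ-recipSum {v = suc k ∷ xs} (_ , x<xs) = begin
  toℚᵘ (recip (suc k) ℚ.+ recipSum xs)
    ≈⟨ toℚᵘ-homo-+ (recip (suc k)) (recipSum xs) ⟩
  toℚᵘ (recip (suc k)) ℚᵘ.+ toℚᵘ (recipSum xs)
    ≈⟨ ℚᵘ.+-cong (toℚᵘ-fromℚᵘ (mkℚᵘ (+ 1) k)) (toℚᵘ-recipSum x<xs) ⟩
  mkℚᵘ (+ 1) k ℚᵘ.+ fraction (recipNumer xs) (product xs)
    ≈⟨ fraction-+ k (recipNumer xs) (product xs) (product-pos x<xs) ⟩
  fraction (recipNumer (suc k ∷ xs)) (product (suc k ∷ xs))
    ∎
  where open ℚᵘ.≃-Reasoning

fraction≃1⇔ : ∀ N P → 0 < P → (fraction N P ≃ᵘ ℚᵘ.1ℚᵘ) ⇔ (N ≡ P)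
fraction≃1⇔ N (suc P) _ = mk⇔
  (λ { (*≡* N*1≡1*P) →
        ℤ.+-injective (trans (sym (ℤ.*-identityʳ (+ N))) (trans N*1≡1*P (ℤ.*-identityˡ _))) })
  (λ N≡P → *≡* (trans (ℤ.*-identityʳ (+ N)) (trans (cong +_ N≡P) (sym (ℤ.*-identityˡ _)))))

recipSum≡1⇔ : ∀ {k lo} {v : Vec ℕ k} → IncreasingAbove lo v →
              (recipSum v ≡ 1ℚ) ⇔ (recipNumer v ≡ product v)
recipSum≡1⇔ {v = v} inc = mk⇔
  (λ sum≡1 → to (ℚᵘ.≃-trans (ℚᵘ.≃-sym (toℚᵘ-recipSum inc)) (toℚᵘ-cong sum≡1)))
  (λ N≡P → toℚᵘ-injective (ℚᵘ.≃-trans (toℚᵘ-recipSum inc) (from N≡P)))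
  where open Equivalence (fraction≃1⇔ (recipNumer v) (product v) (product-pos inc))

admissibleSets : List (ℕ × Vec ℕ 9)
admissibleSets =
    (3 , 2 ∷ 4 ∷ 6 ∷ 18 ∷ 54 ∷ 162 ∷ 486 ∷ 1458 ∷ 2916 ∷ [])
  ∷ (3 , 2 ∷ 4 ∷ 6 ∷ 18 ∷ 54 ∷ 162 ∷ 729 ∷ 972 ∷ 1458 ∷ [])
  ∷ (3 , 2 ∷ 4 ∷ 6 ∷ 18 ∷ 54 ∷ 243 ∷ 324 ∷ 729 ∷ 1458 ∷ [])
  ∷ (3 , 2 ∷ 4 ∷ 6 ∷ 18 ∷ 81 ∷ 108 ∷ 324 ∷ 486 ∷ 972 ∷ [])
  ∷ (3 , 2 ∷ 4 ∷ 6 ∷ 18 ∷ 81 ∷ 108 ∷ 243 ∷ 729 ∷ 1458 ∷ [])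
  ∷ (3 , 2 ∷ 4 ∷ 6 ∷ 18 ∷ 81 ∷ 162 ∷ 243 ∷ 324 ∷ 486 ∷ [])
  ∷ (3 , 2 ∷ 4 ∷ 6 ∷ 27 ∷ 36 ∷ 108 ∷ 162 ∷ 486 ∷ 972 ∷ [])
  ∷ (3 , 2 ∷ 4 ∷ 6 ∷ 27 ∷ 36 ∷ 108 ∷ 243 ∷ 324 ∷ 486 ∷ [])
  ∷ (3 , 2 ∷ 4 ∷ 6 ∷ 27 ∷ 36 ∷ 81 ∷ 324 ∷ 486 ∷ 972 ∷ [])
  ∷ (3 , 2 ∷ 4 ∷ 6 ∷ 27 ∷ 36 ∷ 81 ∷ 243 ∷ 729 ∷ 1458 ∷ [])
  ∷ (3 , 2 ∷ 4 ∷ 6 ∷ 27 ∷ 54 ∷ 81 ∷ 108 ∷ 243 ∷ 486 ∷ [])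
  ∷ (3 , 2 ∷ 4 ∷ 9 ∷ 12 ∷ 36 ∷ 54 ∷ 162 ∷ 486 ∷ 972 ∷ [])
  ∷ (3 , 2 ∷ 4 ∷ 9 ∷ 12 ∷ 36 ∷ 54 ∷ 243 ∷ 324 ∷ 486 ∷ [])
  ∷ (3 , 2 ∷ 4 ∷ 9 ∷ 12 ∷ 36 ∷ 81 ∷ 108 ∷ 243 ∷ 486 ∷ [])
  ∷ (3 , 2 ∷ 4 ∷ 9 ∷ 12 ∷ 27 ∷ 108 ∷ 162 ∷ 486 ∷ 972 ∷ [])
  ∷ (3 , 2 ∷ 4 ∷ 9 ∷ 12 ∷ 27 ∷ 108 ∷ 243 ∷ 324 ∷ 486 ∷ [])
  ∷ (3 , 2 ∷ 4 ∷ 9 ∷ 12 ∷ 27 ∷ 81 ∷ 324 ∷ 486 ∷ 972 ∷ [])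
  ∷ (3 , 2 ∷ 4 ∷ 9 ∷ 12 ∷ 27 ∷ 81 ∷ 243 ∷ 729 ∷ 1458 ∷ [])
  ∷ (3 , 2 ∷ 4 ∷ 9 ∷ 18 ∷ 27 ∷ 36 ∷ 108 ∷ 162 ∷ 324 ∷ [])
  ∷ (3 , 2 ∷ 4 ∷ 9 ∷ 18 ∷ 27 ∷ 36 ∷ 81 ∷ 243 ∷ 486 ∷ [])
  ∷ (3 , 2 ∷ 4 ∷ 9 ∷ 18 ∷ 27 ∷ 54 ∷ 81 ∷ 108 ∷ 162 ∷ [])
  ∷ (3 , 2 ∷ 3 ∷ 12 ∷ 18 ∷ 54 ∷ 162 ∷ 486 ∷ 1458 ∷ 2916 ∷ [])
  ∷ (3 , 2 ∷ 3 ∷ 12 ∷ 18 ∷ 54 ∷ 162 ∷ 729 ∷ 972 ∷ 1458 ∷ [])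
  ∷ (3 , 2 ∷ 3 ∷ 12 ∷ 18 ∷ 54 ∷ 243 ∷ 324 ∷ 729 ∷ 1458 ∷ [])
  ∷ (3 , 2 ∷ 3 ∷ 12 ∷ 18 ∷ 81 ∷ 108 ∷ 324 ∷ 486 ∷ 972 ∷ [])
  ∷ (3 , 2 ∷ 3 ∷ 12 ∷ 18 ∷ 81 ∷ 108 ∷ 243 ∷ 729 ∷ 1458 ∷ [])
  ∷ (3 , 2 ∷ 3 ∷ 12 ∷ 18 ∷ 81 ∷ 162 ∷ 243 ∷ 324 ∷ 486 ∷ [])
  ∷ (3 , 2 ∷ 3 ∷ 12 ∷ 27 ∷ 36 ∷ 108 ∷ 162 ∷ 486 ∷ 972 ∷ [])
  ∷ (3 , 2 ∷ 3 ∷ 12 ∷ 27 ∷ 36 ∷ 108 ∷ 243 ∷ 324 ∷ 486 ∷ [])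
  ∷ (3 , 2 ∷ 3 ∷ 12 ∷ 27 ∷ 36 ∷ 81 ∷ 324 ∷ 486 ∷ 972 ∷ [])
  ∷ (3 , 2 ∷ 3 ∷ 12 ∷ 27 ∷ 36 ∷ 81 ∷ 243 ∷ 729 ∷ 1458 ∷ [])
  ∷ (3 , 2 ∷ 3 ∷ 12 ∷ 27 ∷ 54 ∷ 81 ∷ 108 ∷ 243 ∷ 486 ∷ [])
  ∷ (3 , 2 ∷ 3 ∷ 9 ∷ 36 ∷ 54 ∷ 162 ∷ 486 ∷ 1458 ∷ 2916 ∷ [])
  ∷ (3 , 2 ∷ 3 ∷ 9 ∷ 36 ∷ 54 ∷ 162 ∷ 729 ∷ 972 ∷ 1458 ∷ [])
  ∷ (3 , 2 ∷ 3 ∷ 9 ∷ 36 ∷ 54 ∷ 243 ∷ 324 ∷ 729 ∷ 1458 ∷ [])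
  ∷ (3 , 2 ∷ 3 ∷ 9 ∷ 36 ∷ 81 ∷ 108 ∷ 324 ∷ 486 ∷ 972 ∷ [])
  ∷ (3 , 2 ∷ 3 ∷ 9 ∷ 36 ∷ 81 ∷ 108 ∷ 243 ∷ 729 ∷ 1458 ∷ [])
  ∷ (3 , 2 ∷ 3 ∷ 9 ∷ 36 ∷ 81 ∷ 162 ∷ 243 ∷ 324 ∷ 486 ∷ [])
  ∷ (3 , 2 ∷ 3 ∷ 9 ∷ 27 ∷ 108 ∷ 162 ∷ 486 ∷ 1458 ∷ 2916 ∷ [])
  ∷ (3 , 2 ∷ 3 ∷ 9 ∷ 27 ∷ 108 ∷ 162 ∷ 729 ∷ 972 ∷ 1458 ∷ [])
  ∷ (3 , 2 ∷ 3 ∷ 9 ∷ 27 ∷ 108 ∷ 243 ∷ 324 ∷ 729 ∷ 1458 ∷ [])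
  ∷ (3 , 2 ∷ 3 ∷ 9 ∷ 27 ∷ 81 ∷ 324 ∷ 486 ∷ 1458 ∷ 2916 ∷ [])
  ∷ (3 , 2 ∷ 3 ∷ 9 ∷ 27 ∷ 81 ∷ 324 ∷ 729 ∷ 972 ∷ 1458 ∷ [])
  ∷ (3 , 2 ∷ 3 ∷ 9 ∷ 27 ∷ 81 ∷ 243 ∷ 972 ∷ 1458 ∷ 2916 ∷ [])
  ∷ (3 , 2 ∷ 3 ∷ 9 ∷ 27 ∷ 81 ∷ 243 ∷ 729 ∷ 2187 ∷ 4374 ∷ [])
  ∷ (3 , 2 ∷ 3 ∷ 18 ∷ 27 ∷ 36 ∷ 54 ∷ 81 ∷ 108 ∷ 162 ∷ [])
  ∷ (3 , 2 ∷ 6 ∷ 9 ∷ 12 ∷ 18 ∷ 27 ∷ 36 ∷ 81 ∷ 162 ∷ [])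
  ∷ (3 , 3 ∷ 4 ∷ 6 ∷ 9 ∷ 12 ∷ 36 ∷ 54 ∷ 162 ∷ 324 ∷ [])
  ∷ (3 , 3 ∷ 4 ∷ 6 ∷ 9 ∷ 12 ∷ 36 ∷ 81 ∷ 108 ∷ 162 ∷ [])
  ∷ (3 , 3 ∷ 4 ∷ 6 ∷ 9 ∷ 12 ∷ 27 ∷ 108 ∷ 162 ∷ 324 ∷ [])
  ∷ (3 , 3 ∷ 4 ∷ 6 ∷ 9 ∷ 12 ∷ 27 ∷ 81 ∷ 243 ∷ 486 ∷ [])
  ∷ (3 , 3 ∷ 4 ∷ 6 ∷ 9 ∷ 18 ∷ 27 ∷ 36 ∷ 81 ∷ 162 ∷ [])
  ∷ (5 , 2 ∷ 4 ∷ 5 ∷ 25 ∷ 125 ∷ 625 ∷ 3125 ∷ 15625 ∷ 62500 ∷ [])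
  ∷ (7 , 2 ∷ 4 ∷ 7 ∷ 14 ∷ 49 ∷ 98 ∷ 343 ∷ 686 ∷ 1372 ∷ [])
  ∷ []


admissibleList : List (Vec ℕ 9)
admissibleList = map proj₂ admissibleSets

_≟ᵥ_ : ∀ {k} (v w : Vec ℕ k) → Dec (v ≡ w)
_≟ᵥ_ = ≡-dec _≟_

exponents : List (ℕ × ℕ)
exponents = cartesianProduct (upTo 3) (upTo 12)

OfFormWithin : ℕ → ℕ → Set
OfFormWithin q x = Any (λ (a , b) → a ≤ 2 × x ≡ 2 ^ a * q ^ b) exponents

OfFormWithin⇒OfForm : ∀ {q x} → OfFormWithin q x → OfForm q x
OfFormWithin⇒OfForm form with satisfied form
... | (a , b) , form-ab = a , b , form-ab

AdmissibleWith : ℕ → Vec ℕ 9 → Set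
AdmissibleWith q v =
  IncreasingAbove 0 v × recipNumer v ≡ product v × Prime q × ¬ 2 ∣ q × VAll (OfFormWithin q) v

increasingAbove? : ∀ {k} lo (v : Vec ℕ k) → Dec (IncreasingAbove lo v)
increasingAbove? lo []       = yes tt
increasingAbove? lo (x ∷ xs) = lo <? x ×-dec increasingAbove? x xs

admissibleWith? : ∀ q v → Dec (AdmissibleWith q v)
admissibleWith? q v =
  increasingAbove? 0 v ×-dec recipNumer v ≟ product v ×-dec prime? q ×-dec ¬? (2 ∣? q)
  ×-dec VAll.all? (λ x → any? (λ (a , b) → a ≤? 2 ×-dec x ≟ 2 ^ a * q ^ b) exponents) v

AdmissibleWith⇒Admissible : ∀ {q v} → AdmissibleWith q v → Admissible v
AdmissibleWith⇒Admissible {q} (inc , N≡P , q-prime , odd , form) =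
  IncreasingAbove⇒StrictlyIncreasing inc , lookup⁺ (IncreasingAbove⇒All> inc) ,
  Equivalence.from (recipSum≡1⇔ inc) N≡P ,
  q , q-prime , odd , λ i → OfFormWithin⇒OfForm (lookup⁺ form i)

admissibleSets-certified : All (uncurry AdmissibleWith) admissibleSets
admissibleSets-certified = toWitness {a? = all? (uncurry admissibleWith?) admissibleSets} tt

admissibleList-admissible : All Admissible admissibleList
admissibleList-admissible = map⁺ {f = proj₂} (All.map AdmissibleWith⇒Admissible admissibleSets-certified)

admissibleList-unique : Unique admissibleList
admissibleList-unique = toWitness {a? = unique? _≟ᵥ_ admissibleList} tt

solutions : Candidates → List (Vec ℕ 9)
solutions cands = search cands 9 0 1 1

admissible⇒∈solutions : ∀ {cands P v} → Enumerates cands P → Admissible v → (∀ i → P (lookup v i)) →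
                        v ∈ solutions cands
admissible⇒∈solutions {v = v} enum (increasing , pos , sum≡1 , _) P-v =
  search-complete enum 9 {n = 1} {d = 1} inc (lookup⁻ P-v) z<s (begin
    recipNumer v * 1  ≡⟨ *-identityʳ (recipNumer v) ⟩
    recipNumer v      ≡⟨ Equivalence.to (recipSum≡1⇔ inc) sum≡1 ⟩
    product v         ≡⟨ sym (*-identityˡ (product v)) ⟩
    1 * product v     ∎)
  where
  open ≡-Reasoning
  inc = StrictlyIncreasing⇒IncreasingAbove increasing pos

between3And42 : List ℕ
between3And42 = map (_+_ 3) (upTo 40)

∈-between3And42 : ∀ {q} → 3 ≤ q → q ≤ 42 → q ∈ between3And42
∈-between3And42 {q} 3≤q q≤42 =
  subst (_∈ between3And42) (m+[n∸m]≡n 3≤q) (∈-map⁺ (_+_ 3) (∈-upTo⁺ (s≤s (∸-monoˡ-≤ 3 q≤42))))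

solutions-q≤42 : All (λ q → All (_∈ admissibleList) (solutions (candidates q))) between3And42
solutions-q≤42 = toWitness {a? = all? (λ q → all? (λ v → any? (v ≟ᵥ_) admissibleList) (solutions (candidates q)))
                                      between3And42} tt

solutions-q>42 : solutions (candidatesAbove 42) ≡ []
solutions-q>42 = refl

oddPrime⇒3≤ : ∀ {q} → Prime q → ¬ 2 ∣ q → 3 ≤ q
oddPrime⇒3≤ {0}                 _       2∤q = contradiction (divides 0 refl) 2∤q
oddPrime⇒3≤ {1}                 q-prime _   = contradiction q-prime ¬prime[1]
oddPrime⇒3≤ {2}                 _       2∤q = contradiction (divides 1 refl) 2∤q
oddPrime⇒3≤ {suc (suc (suc _))} _       _   = s≤s (s≤s (s≤s z≤n))

admissible⇒∈admissibleList : ∀ v → Admissible v → v ∈ admissibleList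
admissible⇒∈admissibleList v adm@(_ , _ , _ , q , q-prime , odd , form) with q ≤? 42
... | yes q≤42 = All.lookup (All.lookup solutions-q≤42 (∈-between3And42 3≤q q≤42))
                   (admissible⇒∈solutions (candidates-enumerates (≤-trans (s≤s (s≤s z≤n)) 3≤q)) adm form)
  where 3≤q = oddPrime⇒3≤ q-prime odd
... | no q≰42 = contradiction (subst (v ∈_) solutions-q>42 v∈solutions) λ ()
  where
  v∈solutions : v ∈ solutions (candidatesAbove 42)
  v∈solutions = admissible⇒∈solutions candidatesAbove-enumerates adm
                  (λ i → OfForm⇒SmallOrAbove (≰⇒> q≰42) (form i))

theorem1 : Σ (List (Vec ℕ 9)) (λ L →
               length L ≡ 54
               × Unique L
               × All Admissible L
               × (∀ v → Admissible v → v ∈ L))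
theorem1 = admissibleList , refl , admissibleList-unique , admissibleList-admissible , admissible⇒∈admissibleList
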